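{- Let $G$ be a connected graph with no subgraph isomorphic to $Y$, and let $C=(u_0u_1\dots u_{k-1})$ be an edge-dominating cycle of $G$ of maximum length among edge-dominating cycles, with $k\ge5$ (indices in $\mathbb{Z}_k$). For $i\in\mathbb{Z}_k$ let $N_i=N_G(u_i)\setminus V(C)$. Then for every $i\in\mathbb{Z}_k$ it is not the case that both $N_i\neq\emptyset$ and $N_{i-1}\cap N_{i+1}\neq\emptyset$.
   Context: All graphs are finite and simple. $Y$ is the 7-vertex tree obtained from $K_{1,3}$ by subdividing each edge exactly once. A cycle is edge-dominating if every edge of $G$ has at least one endpoint on it. -}

module Defs where

open import Data.Nat using (ℕ; zero; suc; _+_; _≤_)
open import Data.Nat.DivMod using (_mod_)
open import Data.Fin using (Fin; toℕ)
open import Data.Product using (Σ; ∃; _×_; _,_)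
open import Data.Sum using (_⊎_)
open import Relation.Nullary using (¬_; Dec)
open import Relation.Binary.PropositionalEquality using (_≡_; _≢_)
open import Function.Definitions using (Injective)

record Graph (n : ℕ) : Set₁ where
  field
    E      : Fin n → Fin n → Set
    E-dec  : ∀ x y → Dec (E x y)
    E-sym  : ∀ {x y} → E x y → E y x
    E-irr  : ∀ x → ¬ E x x
open Graph public

next : ∀ {k} → Fin k → Fin k
next {suc m} i = suc (toℕ i) mod suc m

prev : ∀ {k} → Fin k → Fin k
prev {suc m} i = (toℕ i + m) mod suc m

data Walk {n} (G : Graph n) : Fin n → Fin n → Set where
  here : ∀ {x} → Walk G x x
  step : ∀ {x y z} → E G x y → Walk G y z → Walk G x z

Connected : ∀ {n} → Graph n → Set
Connected {n} G = (x y : Fin n) → Walk G x y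

-- The tree Y: K_{1,3} with each edge subdivided once.
-- Vertex 0 is the centre, 1,2,3 its neighbours, 4,5,6 the leaves attached to 1,2,3.
data YEdge : Fin 7 → Fin 7 → Set where
  e01 : YEdge (Fin.zero) (Fin.suc Fin.zero)
  e02 : YEdge (Fin.zero) (Fin.suc (Fin.suc Fin.zero))
  e03 : YEdge (Fin.zero) (Fin.suc (Fin.suc (Fin.suc Fin.zero)))
  e14 : YEdge (Fin.suc Fin.zero) (Fin.suc (Fin.suc (Fin.suc (Fin.suc Fin.zero))))
  e25 : YEdge (Fin.suc (Fin.suc Fin.zero)) (Fin.suc (Fin.suc (Fin.suc (Fin.suc (Fin.suc Fin.zero)))))
  e36 : YEdge (Fin.suc (Fin.suc (Fin.suc Fin.zero))) (Fin.suc (Fin.suc (Fin.suc (Fin.suc (Fin.suc (Fin.suc Fin.zero))))))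

HasY : ∀ {n} → Graph n → Set
HasY {n} G = Σ (Fin 7 → Fin n) λ f → Injective _≡_ _≡_ f × (∀ a b → YEdge a b → E G (f a) (f b))

YFree : ∀ {n} → Graph n → Set
YFree G = ¬ HasY G

record IsCycle {n} (G : Graph n) (k : ℕ) (u : Fin k → Fin n) : Set where
  field
    len≥3   : 3 ≤ k
    inj     : Injective _≡_ _≡_ u
    adjNext : ∀ i → E G (u i) (u (next i))

OnCycle : ∀ {n k} → (Fin k → Fin n) → Fin n → Set
OnCycle {k = k} u x = ∃ λ (j : Fin k) → u j ≡ x

EdgeDominating : ∀ {n} (G : Graph n) {k} → (Fin k → Fin n) → Set
EdgeDominating {n} G u = ∀ (x y : Fin n) → E G x y → OnCycle u x ⊎ OnCycle u y

MaxEDCycle : ∀ {n} (G : Graph n) (k : ℕ) → (Fin k → Fin n) → Set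
MaxEDCycle {n} G k u =
  IsCycle G k u × EdgeDominating G u ×
  (∀ (k' : ℕ) (u' : Fin k' → Fin n) → IsCycle G k' u' → EdgeDominating G u' → k' ≤ k)

InN : ∀ {n} (G : Graph n) {k} → (Fin k → Fin n) → Fin k → Fin n → Set
InN G u i x = E G (u i) x × ¬ OnCycle u x

module Submission where

-- If the outer neighbours x ∈ N_i and y ∈ N_{i-1} ∩ N_{i+1} coincide, x can be spliced into C
-- between u_{i-1} and u_i, giving a longer cycle that is still edge-dominating.  Otherwise
-- u_{i+1} is the centre of a Y with legs u_{i+1} u_i x, u_{i+1} y u_{i-1} and
-- u_{i+1} u_{i+2} u_{i+3}; the bound k ≥ 5 makes these five cycle vertices distinct.

open import Defs
open import Data.Bool using (Bool; true; false; if_then_else_)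
open import Data.Empty using (⊥-elim)
open import Data.Fin using (Fin; zero; suc; toℕ; fromℕ; inject₁)
open import Data.Fin.Properties using (toℕ-injective; toℕ-fromℕ<; toℕ-fromℕ; toℕ-inject₁; toℕ<n; toℕ≤n; _≟_)
open import Data.Fin.Relation.Unary.Top using (view; ‵fromℕ; ‵inj₁)
open import Data.Nat using (ℕ; suc; _+_; _∸_; _%_; _≤_; _<_; s≤s; NonZero)
open import Data.Nat.DivMod using (_mod_; %-distribˡ-+; m%n%n≡m%n; [m+n]%n≡m%n; m<n⇒m%n≡m; n%n≡0; m%n<n)
open import Data.Nat.Properties using (+-comm; +-assoc; +-identityʳ; +-suc; m+[n∸m]≡n; m∸n+n≡m; ≤-refl; ≤-trans; m≤n⇒m≤1+n; 1+n≰n)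
open import Data.Product using (∃; _×_; _,_)
open import Data.Sum using (_⊎_; inj₁; inj₂; [_,_]) renaming (map to ⊎-map)
open import Function using (_∘_)
open import Function.Definitions using (Injective)
open import Relation.Nullary using (¬_; yes; no)
open import Relation.Binary.PropositionalEquality using (_≡_; _≢_; refl; sym; trans; cong; subst; module ≡-Reasoning)

open ≡-Reasoning

[m+n%o]%o≡[m+n]%o : ∀ m n o .{{_ : NonZero o}} → (m + n % o) % o ≡ (m + n) % o
[m+n%o]%o≡[m+n]%o m n o = begin
  (m + n % o) % o          ≡⟨ %-distribˡ-+ m (n % o) o ⟩
  (m % o + n % o % o) % o  ≡⟨ cong (λ r → (m % o + r) % o) (m%n%n≡m%n n o) ⟩
  (m % o + n % o) % o      ≡⟨ %-distribˡ-+ m n o ⟨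
  (m + n) % o              ∎

[m+[n+p]%o]%o≡p%o : ∀ m n p o .{{_ : NonZero o}} → m + n ≡ o → (m + (n + p) % o) % o ≡ p % o
[m+[n+p]%o]%o≡p%o m n p o m+n≡o = begin
  (m + (n + p) % o) % o  ≡⟨ [m+n%o]%o≡[m+n]%o m (n + p) o ⟩
  (m + (n + p)) % o      ≡⟨ cong (_% o) (+-assoc m n p) ⟨
  (m + n + p) % o        ≡⟨ cong (λ r → (r + p) % o) m+n≡o ⟩
  (o + p) % o            ≡⟨ cong (_% o) (+-comm o p) ⟩
  (p + o) % o            ≡⟨ [m+n]%n≡m%n p o ⟩
  p % o                  ∎

toℕ-mod : ∀ a n .{{_ : NonZero n}} → toℕ (a mod n) ≡ a % n
toℕ-mod a n = toℕ-fromℕ< (m%n<n a n)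

next-fromℕ : ∀ m → next (fromℕ m) ≡ zero
next-fromℕ m = toℕ-injective (begin
  toℕ (next (fromℕ m))         ≡⟨ toℕ-mod (suc (toℕ (fromℕ m))) (suc m) ⟩
  suc (toℕ (fromℕ m)) % suc m  ≡⟨ cong (λ r → suc r % suc m) (toℕ-fromℕ m) ⟩
  suc m % suc m                ≡⟨ n%n≡0 (suc m) ⟩
  0                            ∎)

next-inject₁ : ∀ {m} (j : Fin m) → next (inject₁ j) ≡ suc j
next-inject₁ {m} j = toℕ-injective (begin
  toℕ (next (inject₁ j))         ≡⟨ toℕ-mod (suc (toℕ (inject₁ j))) (suc m) ⟩
  suc (toℕ (inject₁ j)) % suc m  ≡⟨ cong (λ r → suc r % suc m) (toℕ-inject₁ j) ⟩
  suc (toℕ j) % suc m            ≡⟨ m<n⇒m%n≡m (s≤s (toℕ<n j)) ⟩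
  suc (toℕ j)                    ∎)

module _ {m : ℕ} where

  infixl 6 _⊕_
  _⊕_ : Fin (suc m) → ℕ → Fin (suc m)
  i ⊕ d = (toℕ i + d) mod suc m

  ⊕-identityʳ : ∀ i → i ⊕ 0 ≡ i
  ⊕-identityʳ i = toℕ-injective (begin
    toℕ (i ⊕ 0)          ≡⟨ toℕ-mod (toℕ i + 0) (suc m) ⟩
    (toℕ i + 0) % suc m  ≡⟨ cong (_% suc m) (+-identityʳ (toℕ i)) ⟩
    toℕ i % suc m        ≡⟨ m<n⇒m%n≡m (toℕ<n i) ⟩
    toℕ i                ∎)

  next-⊕ : ∀ i d → next (i ⊕ d) ≡ i ⊕ suc d
  next-⊕ i d = toℕ-injective (begin
    toℕ (next (i ⊕ d))                 ≡⟨ toℕ-mod (suc (toℕ (i ⊕ d))) (suc m) ⟩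
    suc (toℕ (i ⊕ d)) % suc m          ≡⟨ cong (λ r → suc r % suc m) (toℕ-mod (toℕ i + d) (suc m)) ⟩
    (1 + (toℕ i + d) % suc m) % suc m  ≡⟨ [m+n%o]%o≡[m+n]%o 1 (toℕ i + d) (suc m) ⟩
    suc (toℕ i + d) % suc m            ≡⟨ cong (_% suc m) (+-suc (toℕ i) d) ⟨
    (toℕ i + suc d) % suc m            ≡⟨ toℕ-mod (toℕ i + suc d) (suc m) ⟨
    toℕ (i ⊕ suc d)                    ∎)

  ⊕-period : ∀ i → i ⊕ suc m ≡ i
  ⊕-period i = toℕ-injective (begin
    toℕ (i ⊕ suc m)          ≡⟨ toℕ-mod (toℕ i + suc m) (suc m) ⟩
    (toℕ i + suc m) % suc m  ≡⟨ [m+n]%n≡m%n (toℕ i) (suc m) ⟩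
    toℕ i % suc m            ≡⟨ m<n⇒m%n≡m (toℕ<n i) ⟩
    toℕ i                    ∎)

  prev-⊕-suc : ∀ i d → prev i ⊕ suc d ≡ i ⊕ d
  prev-⊕-suc i 0 = begin
    prev i ⊕ 1           ≡⟨ next-⊕ (prev i) 0 ⟨
    next (prev i ⊕ 0)    ≡⟨ cong next (⊕-identityʳ (prev i)) ⟩
    next (i ⊕ m)         ≡⟨ next-⊕ i m ⟩
    i ⊕ suc m            ≡⟨ ⊕-period i ⟩
    i                    ≡⟨ ⊕-identityʳ i ⟨
    i ⊕ 0                ∎
  prev-⊕-suc i (suc d) = begin
    prev i ⊕ suc (suc d)  ≡⟨ next-⊕ (prev i) (suc d) ⟨
    next (prev i ⊕ suc d) ≡⟨ cong next (prev-⊕-suc i d) ⟩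
    next (i ⊕ d)          ≡⟨ next-⊕ i d ⟩
    i ⊕ suc d             ∎

  -- Adding suc m ∸ toℕ i modulo suc m undoes the rotation by i.
  ⊕-cancelˡ : ∀ i {d e} → d < suc m → e < suc m → i ⊕ d ≡ i ⊕ e → d ≡ e
  ⊕-cancelˡ i {d} {e} d<k e<k i⊕d≡i⊕e = begin
    d                                   ≡⟨ m<n⇒m%n≡m d<k ⟨
    d % suc m                           ≡⟨ unrotate d ⟨
    (suc m ∸ toℕ i + toℕ (i ⊕ d)) % suc m ≡⟨ cong (λ j → (suc m ∸ toℕ i + toℕ j) % suc m) i⊕d≡i⊕e ⟩
    (suc m ∸ toℕ i + toℕ (i ⊕ e)) % suc m ≡⟨ unrotate e ⟩
    e % suc m                           ≡⟨ m<n⇒m%n≡m e<k ⟩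
    e                                   ∎
    where
    unrotate : ∀ d → (suc m ∸ toℕ i + toℕ (i ⊕ d)) % suc m ≡ d % suc m
    unrotate d = trans (cong (λ r → (suc m ∸ toℕ i + r) % suc m) (toℕ-mod (toℕ i + d) (suc m)))
                       ([m+[n+p]%o]%o≡p%o (suc m ∸ toℕ i) (toℕ i) d (suc m) (m∸n+n≡m (toℕ≤n i)))

  ⊕-surjective : ∀ i j → ∃ λ (d : Fin (suc m)) → i ⊕ toℕ d ≡ j
  ⊕-surjective i j = d , toℕ-injective (begin
      toℕ (i ⊕ toℕ d)                                   ≡⟨ toℕ-mod (toℕ i + toℕ d) (suc m) ⟩
      (toℕ i + toℕ d) % suc m                           ≡⟨ cong (λ r → (toℕ i + r) % suc m) (toℕ-mod (suc m ∸ toℕ i + toℕ j) (suc m)) ⟩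
      (toℕ i + (suc m ∸ toℕ i + toℕ j) % suc m) % suc m ≡⟨ [m+[n+p]%o]%o≡p%o (toℕ i) (suc m ∸ toℕ i) (toℕ j) (suc m) (m+[n∸m]≡n (toℕ≤n i)) ⟩
      toℕ j % suc m                                     ≡⟨ m<n⇒m%n≡m (toℕ<n j) ⟩
      toℕ j                                             ∎)
    where
    d : Fin (suc m)
    d = (suc m ∸ toℕ i + toℕ j) mod suc m

arc : ∀ {n m l} → (Fin (suc m) → Fin n) → Fin (suc m) → Fin l → Fin n
arc u i d = u (i ⊕ toℕ d)

module _ {n m} {G : Graph n} {u : Fin (suc m) → Fin n} (C : IsCycle G (suc m) u) where
  open IsCycle C

  adj-⊕ : ∀ i d → E G (u (i ⊕ d)) (u (i ⊕ suc d))
  adj-⊕ i d = subst (E G (u (i ⊕ d)) ∘ u) (next-⊕ i d) (adjNext (i ⊕ d))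

  arc-injective : ∀ {l} → l ≤ suc m → ∀ i → Injective _≡_ _≡_ (arc {l = l} u i)
  arc-injective l≤k i {d} {e} eq =
    toℕ-injective (⊕-cancelˡ i (≤-trans (toℕ<n d) l≤k) (≤-trans (toℕ<n e) l≤k) (inj eq))

  arc-adj : ∀ {l} i (d : Fin l) → E G (arc u i (inject₁ d)) (arc u i (suc d))
  arc-adj i d = subst (λ e → E G (u (i ⊕ e)) (u (i ⊕ suc (toℕ d)))) (sym (toℕ-inject₁ d)) (adj-⊕ i (toℕ d))

  -- C with x spliced in between u_{i-1} and u_i, read starting from x.
  detour : Fin n → Fin (suc m) → Fin (suc (suc m)) → Fin n
  detour x i zero    = x
  detour x i (suc d) = arc u i d

  module _ {x : Fin n} {i : Fin (suc m)} where

    detour-injective : ¬ OnCycle u x → Injective _≡_ _≡_ (detour x i)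
    detour-injective x∉C {zero}  {zero}  _  = refl
    detour-injective x∉C {zero}  {suc e} eq = ⊥-elim (x∉C (_ , sym eq))
    detour-injective x∉C {suc d} {zero}  eq = ⊥-elim (x∉C (_ , eq))
    detour-injective x∉C {suc d} {suc e} eq = cong suc (arc-injective ≤-refl i eq)

    detour-adj : E G (u (prev i)) x → E G x (u i) → ∀ a → E G (detour x i a) (detour x i (next a))
    detour-adj ux xu a with view a
    ... | ‵fromℕ = subst (E G (u (i ⊕ toℕ (fromℕ m))) ∘ detour x i) (sym (next-fromℕ (suc m)))
                         (subst (λ d → E G (u (i ⊕ d)) x) (sym (toℕ-fromℕ m)) ux)
    ... | ‵inj₁ {i = zero} _  = subst (E G x ∘ detour x i) (sym (next-inject₁ zero))
                                      (subst (E G x ∘ u) (sym (⊕-identityʳ i)) xu)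
    ... | ‵inj₁ {i = suc d} _ = subst (E G (u (i ⊕ toℕ (inject₁ d))) ∘ detour x i) (sym (next-inject₁ (suc d)))
                                      (arc-adj i d)

    detour-isCycle : ¬ OnCycle u x → E G (u (prev i)) x → E G x (u i) →
                     IsCycle G (suc (suc m)) (detour x i)
    detour-isCycle x∉C ux xu = record
      { len≥3   = m≤n⇒m≤1+n len≥3
      ; inj     = detour-injective x∉C
      ; adjNext = detour-adj ux xu
      }

    detour-onCycle : ∀ {y} → OnCycle u y → OnCycle (detour x i) y
    detour-onCycle (j , uj≡y) with ⊕-surjective i j
    ... | d , i⊕d≡j = suc d , trans (cong u i⊕d≡j) uj≡y

    detour-edgeDominating : EdgeDominating G u → EdgeDominating G (detour x i)
    detour-edgeDominating ed a b ab = ⊎-map detour-onCycle detour-onCycle (ed a b ab)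

MaxEDCycle⇒¬commonOuterNeighbour : ∀ {n m} {G : Graph n} {u : Fin (suc m) → Fin n} →
  MaxEDCycle G (suc m) u → ∀ i {x} → ¬ (InN G u (prev i) x × InN G u i x)
MaxEDCycle⇒¬commonOuterNeighbour {G = G} (C , ed , maximal) i {x} ((ux , x∉C) , (xu , _)) =
  1+n≰n (maximal _ _ (detour-isCycle C {x} {i} x∉C ux (E-sym G xu)) (detour-edgeDominating C {x} {i} ed))

[,]-injective : ∀ {A B C : Set} {f : A → C} {g : B → C} →
  Injective _≡_ _≡_ f → Injective _≡_ _≡_ g → (∀ a b → f a ≢ g b) → Injective _≡_ _≡_ [ f , g ]
[,]-injective f-inj g-inj f≢g {inj₁ a} {inj₁ a′} eq = cong inj₁ (f-inj eq)
[,]-injective f-inj g-inj f≢g {inj₁ a} {inj₂ b}  eq = ⊥-elim (f≢g a b eq)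
[,]-injective f-inj g-inj f≢g {inj₂ b} {inj₁ a}  eq = ⊥-elim (f≢g a b (sym eq))
[,]-injective f-inj g-inj f≢g {inj₂ b} {inj₂ b′} eq = cong inj₂ (g-inj eq)

-- The copy of Y centred at w₂ with legs w₂ w₁ x, w₂ y w₀ and w₂ w₃ w₄,
-- where inj₁ d stands for w_d, inj₂ true for x and inj₂ false for y.
Y-placement : Fin 7 → Fin 5 ⊎ Bool
Y-placement zero                                   = inj₁ (suc (suc zero))
Y-placement (suc zero)                             = inj₁ (suc zero)
Y-placement (suc (suc zero))                       = inj₂ false
Y-placement (suc (suc (suc zero)))                 = inj₁ (suc (suc (suc zero)))
Y-placement (suc (suc (suc (suc zero))))           = inj₂ true
Y-placement (suc (suc (suc (suc (suc zero)))))     = inj₁ zero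
Y-placement (suc (suc (suc (suc (suc (suc zero)))))) = inj₁ (suc (suc (suc (suc zero))))

Y-placement⁻¹ : Fin 5 ⊎ Bool → Fin 7
Y-placement⁻¹ (inj₁ zero)                             = suc (suc (suc (suc (suc zero))))
Y-placement⁻¹ (inj₁ (suc zero))                       = suc zero
Y-placement⁻¹ (inj₁ (suc (suc zero)))                 = zero
Y-placement⁻¹ (inj₁ (suc (suc (suc zero))))           = suc (suc (suc zero))
Y-placement⁻¹ (inj₁ (suc (suc (suc (suc zero)))))     = suc (suc (suc (suc (suc (suc zero)))))
Y-placement⁻¹ (inj₂ true)                             = suc (suc (suc (suc zero)))
Y-placement⁻¹ (inj₂ false)                            = suc (suc zero)

Y-placement⁻¹-inverse : ∀ a → Y-placement⁻¹ (Y-placement a) ≡ a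
Y-placement⁻¹-inverse zero                                   = refl
Y-placement⁻¹-inverse (suc zero)                             = refl
Y-placement⁻¹-inverse (suc (suc zero))                       = refl
Y-placement⁻¹-inverse (suc (suc (suc zero)))                 = refl
Y-placement⁻¹-inverse (suc (suc (suc (suc zero))))           = refl
Y-placement⁻¹-inverse (suc (suc (suc (suc (suc zero)))))     = refl
Y-placement⁻¹-inverse (suc (suc (suc (suc (suc (suc zero)))))) = refl

Y-placement-injective : Injective _≡_ _≡_ Y-placement
Y-placement-injective {a} {b} eq = begin
  a                             ≡⟨ Y-placement⁻¹-inverse a ⟨
  Y-placement⁻¹ (Y-placement a) ≡⟨ cong Y-placement⁻¹ eq ⟩
  Y-placement⁻¹ (Y-placement b) ≡⟨ Y-placement⁻¹-inverse b ⟩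
  b                             ∎

module _ {n} (G : Graph n) (w : Fin 5 → Fin n) (x y : Fin n) where

  private
    vertex : Fin 5 ⊎ Bool → Fin n
    vertex = [ w , (λ b → if b then x else y) ]

  HasY-fromPath : Injective _≡_ _≡_ w → (∀ d → E G (w (inject₁ d)) (w (suc d))) →
    x ≢ y → (∀ d → w d ≢ x) → (∀ d → w d ≢ y) →
    E G (w (suc zero)) x → E G (w (suc (suc zero))) y → E G (w zero) y → HasY G
  HasY-fromPath w-inj path x≢y w≢x w≢y w₁x w₂y w₀y = vertex ∘ Y-placement , embedding , edges
    where
    outer-injective : Injective _≡_ _≡_ (λ b → if b then x else y)
    outer-injective {true}  {true}  _  = refl
    outer-injective {true}  {false} eq = ⊥-elim (x≢y eq)
    outer-injective {false} {true}  eq = ⊥-elim (x≢y (sym eq))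
    outer-injective {false} {false} _  = refl

    embedding : Injective _≡_ _≡_ (vertex ∘ Y-placement)
    embedding = Y-placement-injective ∘ [,]-injective w-inj outer-injective w≢outer
      where
      w≢outer : ∀ d b → w d ≢ (if b then x else y)
      w≢outer d true  = w≢x d
      w≢outer d false = w≢y d

    edges : ∀ a b → YEdge a b → E G (vertex (Y-placement a)) (vertex (Y-placement b))
    edges _ _ e01 = E-sym G (path (suc zero))
    edges _ _ e02 = w₂y
    edges _ _ e03 = path (suc (suc zero))
    edges _ _ e14 = w₁x
    edges _ _ e25 = E-sym G w₀y
    edges _ _ e36 = path (suc (suc (suc zero)))

module _ {n m} {G : Graph n} {u : Fin (suc m) → Fin n} (C : IsCycle G (suc m) u) where

  private
    reindex : ∀ {j j′ z} → j ≡ j′ → E G (u j′) z → E G (u j) z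
    reindex {z = z} j≡j′ = subst (λ j → E G (u j) z) (sym j≡j′)

  -- The path is w_d = u_{i-1+d}, so the Y is centred at u_{i+1}.
  distinctOuterNeighbours⇒HasY : 5 ≤ suc m → ∀ i {x y} → x ≢ y →
    InN G u i x → InN G u (prev i) y → InN G u (next i) y → HasY G
  distinctOuterNeighbours⇒HasY 5≤k i {x} {y} x≢y (u₁x , x∉C) (u₀y , y∉C) (u₂y , _) =
    HasY-fromPath G (arc u (prev i)) x y (arc-injective C 5≤k (prev i)) (arc-adj C (prev i))
      x≢y (λ _ eq → x∉C (_ , eq)) (λ _ eq → y∉C (_ , eq))
      (reindex (trans (prev-⊕-suc i 0) (⊕-identityʳ i)) u₁x)
      (reindex prev⊕2≡next u₂y)
      (reindex (⊕-identityʳ (prev i)) u₀y)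
    where
    prev⊕2≡next : prev i ⊕ 2 ≡ next i
    prev⊕2≡next = begin
      prev i ⊕ 2    ≡⟨ prev-⊕-suc i 1 ⟩
      i ⊕ 1         ≡⟨ next-⊕ i 0 ⟨
      next (i ⊕ 0)  ≡⟨ cong next (⊕-identityʳ i) ⟩
      next i        ∎

lemma4p7 : ∀ {n} (G : Graph n) → Connected G → YFree G →
           ∀ (k : ℕ) (u : Fin k → Fin n) → MaxEDCycle G k u → 5 ≤ k →
           ∀ (i : Fin k) →
             ¬ ((∃ λ x → InN G u i x) × (∃ λ y → InN G u (prev i) y × InN G u (next i) y))
lemma4p7 G _ Y-free (suc m) u maxC@(C , _) 5≤k i ((x , ix) , (y , prev-y , next-y)) with x ≟ y
... | yes refl = MaxEDCycle⇒¬commonOuterNeighbour maxC i (prev-y , ix)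
... | no x≢y   = Y-free (distinctOuterNeighbours⇒HasY C 5≤k i x≢y ix prev-y next-y)
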